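{- Let $\langle L,\sqsubseteq,\bot,\sqcup\rangle$ be a CPO (every increasing chain, including the empty one, has a least upper bound in $L$) and let $f:L\to L$ be increasing. Let $P\in L$. Assume there is a transfinite sequence $(X^\delta)_{\delta\in\mathbb{O}}$ of elements of $L$ with $X^0=\bot$, $X^{\delta+1}\sqsubseteq f(X^\delta)$ for all ordinals $\delta$, and $X^\lambda\sqsubseteq\bigsqcup_{\beta<\lambda}X^\beta$ for all limit ordinals $\lambda$. Assume further there is a well-founded set $\langle W,\preceq\rangle$ and a function $\nu:\{X^\delta\mid\delta\in\mathbb{O}\}\to W$ such that for all ordinals $\beta<\delta$, $P\not\sqsubseteq X^\beta$ implies $\nu(X^\beta)\succ\nu(X^\delta)$. Then there exists $\delta<\omega$ with $P\sqsubseteq X^\delta\sqsubseteq f^\delta\sqsubseteq\mathrm{lfp}^{\sqsubseteq}f$.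
   Context: $\mathbb{O}$ is the class of ordinals and $\omega$ the first infinite ordinal. A set $W$ with a binary relation $\preceq$ is well-founded if it has no infinite strictly decreasing chain ($\succ$ denotes the strict converse). The transfinite iterates of $f$ from $\bot$ are $f^0=\bot$, $f^{\delta+1}=f(f^\delta)$, $f^\lambda=\bigsqcup_{\beta<\lambda}f^\beta$ for limit $\lambda$; $\mathrm{lfp}^{\sqsubseteq}f$ is the least fixpoint of $f$. -}

module Defs where

open import Level using (Level; _⊔_; Lift) renaming (suc to lsuc)
open import Data.Nat using (ℕ) renaming (zero to nzero; suc to nsuc)
open import Data.Product using (Σ; ∃; ∃-syntax; _×_; _,_)
open import Data.Sum using (_⊎_)
open import Relation.Nullary using (¬_)
open import Relation.Unary using (Pred)
import Data.Empty as Empty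
open import Relation.Binary using (Rel; IsPartialOrder; IsStrictTotalOrder)
open import Relation.Binary.PropositionalEquality using (_≡_; _≢_)
open import Induction.WellFounded using (WellFounded)

module _ {c ℓ : Level} {A : Set c} (_⊑_ : Rel A ℓ) where
  IsUpperBound : ∀ {p} → Pred A p → A → Set (c ⊔ ℓ ⊔ p)
  IsUpperBound S u = ∀ {x} → S x → x ⊑ u

  IsLub : ∀ {p} → Pred A p → A → Set (c ⊔ ℓ ⊔ p)
  IsLub S u = IsUpperBound S u × (∀ v → IsUpperBound S v → u ⊑ v)

record CPO (c ℓ : Level) : Set (lsuc (c ⊔ ℓ)) where
  field
    Carrier        : Set c
    _⊑_            : Rel Carrier ℓ
    isPartialOrder : IsPartialOrder _≡_ _⊑_

  IsChain : Pred Carrier (c ⊔ ℓ) → Set (c ⊔ ℓ)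
  IsChain C = ∀ {x y} → C x → C y → (x ⊑ y) ⊎ (y ⊑ x)

  field
    ⨆     : (C : Pred Carrier (c ⊔ ℓ)) → IsChain C → Carrier
    ⨆-lub : (C : Pred Carrier (c ⊔ ℓ)) (ch : IsChain C) → IsLub _⊑_ C (⨆ C ch)

  ⊥ : Carrier
  ⊥ = ⨆ (λ _ → Lift (c ⊔ ℓ) Empty.⊥) (λ ())

  iter : (Carrier → Carrier) → ℕ → Carrier
  iter f nzero    = ⊥
  iter f (nsuc n) = f (iter f n)

  IsLfp : (Carrier → Carrier) → Carrier → Set (c ⊔ ℓ)
  IsLfp f l = (f l ≡ l) × (∀ x → f x ≡ x → l ⊑ x)

record Ordinals (a r : Level) : Set (lsuc (a ⊔ r)) where
  field
    Ord                : Set a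
    _<_                : Rel Ord r
    isStrictTotalOrder : IsStrictTotalOrder _≡_ _<_
    wellFounded        : WellFounded _<_
    zero               : Ord
    zero-least         : ∀ δ → ¬ (δ < zero)
    suc                : Ord → Ord
    suc-greater        : ∀ δ → δ < suc δ
    suc-least          : ∀ δ γ → δ < γ → (suc δ ≡ γ) ⊎ (suc δ < γ)

  IsLimit : Ord → Set a
  IsLimit lam = (lam ≢ zero) × (∀ δ → lam ≢ suc δ)

  -- the finite ordinals n (those δ with δ < ω)
  fin : ℕ → Ord
  fin nzero    = zero
  fin (nsuc n) = suc (fin n)

-- W well-founded in the paper's sense: no infinite strictly decreasing chain.
module _ {w w' : Level} {W : Set w} (_⪯_ : Rel W w') where
  _≻_ : Rel W (w ⊔ w')
  x ≻ y = (y ⪯ x) × (x ≢ y)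

  NoInfiniteDescent : Set (w ⊔ w')
  NoInfiniteDescent = ¬ (Σ (ℕ → W) λ s → ∀ n → s n ≻ s (nsuc n))

module Submission where

-- By excluded middle, either P is reached at some finite stage, or ν(X 0) ≻ ν(X 1) ≻ ν(X 2) ≻ …
-- is an infinite descent in W. The finite stages are dominated by Kleene's iterates
-- f^n ⊥, which lie below every fixpoint.

open import Defs
open import Level using (Level)
open import Data.Nat using (ℕ)
import Data.Nat as ℕ
open import Data.Product using (Σ; ∃; ∃-syntax; _×_; _,_; proj₁; proj₂)
open import Relation.Nullary using (¬_; yes; no; contradiction)
open import Relation.Unary using (Pred)
open import Relation.Binary using (Rel; IsPartialOrder)
open import Relation.Binary.PropositionalEquality using (_≡_; refl)
open import Axiom.ExcludedMiddle using (ExcludedMiddle)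

∃-unless-infiniteDescent : ∀ {ℓ w w'} → ExcludedMiddle ℓ →
  {W : Set w} (_⪯_ : Rel W w') → NoInfiniteDescent _⪯_ →
  (Q : Pred ℕ ℓ) (s : ℕ → W) → (∀ n → ¬ Q n → _≻_ _⪯_ (s n) (s (ℕ.suc n))) →
  ∃ Q
∃-unless-infiniteDescent em _⪯_ noDescent Q s descends with em {∃ Q}
... | yes q = q
... | no ¬q = contradiction (s , λ n → descends n (λ qn → ¬q (n , qn))) noDescent

module _ {c ℓ : Level} (L : CPO c ℓ) where
  open CPO L
  open IsPartialOrder isPartialOrder using (trans; reflexive)

  ⊥-minimum : ∀ x → ⊥ ⊑ x
  ⊥-minimum x = proj₂ (⨆-lub _ (λ ())) x (λ ())

  module _ (f : Carrier → Carrier) (mono : ∀ {x y} → x ⊑ y → f x ⊑ f y) where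

    iter-⊑-prefixpoint : ∀ {l} → f l ⊑ l → ∀ n → iter f n ⊑ l
    iter-⊑-prefixpoint {l} fl⊑l ℕ.zero    = ⊥-minimum l
    iter-⊑-prefixpoint     fl⊑l (ℕ.suc n) = trans (mono (iter-⊑-prefixpoint fl⊑l n)) fl⊑l

    iter-⊑-lfp : ∀ n l → IsLfp f l → iter f n ⊑ l
    iter-⊑-lfp n l (fl≡l , _) = iter-⊑-prefixpoint (reflexive fl≡l) n

    module _ {a r : Level} (O : Ordinals a r) where
      open Ordinals O using (Ord; fin) renaming (zero to 0ₒ; suc to sucₒ)

      fin-⊑-iter : (X : Ord → Carrier) → X 0ₒ ≡ ⊥ → (∀ δ → X (sucₒ δ) ⊑ f (X δ)) →
        ∀ n → X (fin n) ⊑ iter f n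
      fin-⊑-iter X X0≡⊥ X-suc ℕ.zero    = reflexive X0≡⊥
      fin-⊑-iter X X0≡⊥ X-suc (ℕ.suc n) = trans (X-suc (fin n)) (mono (fin-⊑-iter X X0≡⊥ X-suc n))

mainTheorem5 : ∀ {c ℓ a r w w'} → ExcludedMiddle ℓ →
  (L : CPO c ℓ) (O : Ordinals a r) →
  let open CPO L
      open Ordinals O
  in (f : Carrier → Carrier) → (∀ {x y} → x ⊑ y → f x ⊑ f y) →
     (P : Carrier) →
     (X : Ord → Carrier) →
     X zero ≡ ⊥ →
     (∀ δ → X (suc δ) ⊑ f (X δ)) →
     (∀ lam → IsLimit lam → ∀ u → IsLub _⊑_ (λ x → ∃[ β ] ((β < lam) × (X β ≡ x))) u → X lam ⊑ u) →
     (W : Set w) (_⪯_ : Rel W w') → NoInfiniteDescent _⪯_ →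
     (ν : (Σ Carrier λ x → ∃[ δ ] (X δ ≡ x)) → W) →
     (∀ β δ → β < δ → ¬ (P ⊑ X β) → _≻_ _⪯_ (ν (X β , β , refl)) (ν (X δ , δ , refl))) →
     ∃[ n ] ((P ⊑ X (fin n)) × (X (fin n) ⊑ iter f n) × (∀ l → IsLfp f l → iter f n ⊑ l))
mainTheorem5 em L O f mono P X X0≡⊥ X-suc _ _ _⪯_ noDescent ν ν-descends =
  n , P⊑Xn , fin-⊑-iter L f mono O X X0≡⊥ X-suc n , λ l → iter-⊑-lfp L f mono n l
  where
  open CPO L
  open Ordinals O

  reached : ∃[ n ] (P ⊑ X (fin n))
  reached = ∃-unless-infiniteDescent em _⪯_ noDescent (λ n → P ⊑ X (fin n))
    (λ n → ν (X (fin n) , fin n , refl))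
    (λ n → ν-descends (fin n) (suc (fin n)) (suc-greater (fin n)))

  n : ℕ
  n = proj₁ reached

  P⊑Xn : P ⊑ X (fin n)
  P⊑Xn = proj₂ reached
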